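{- For all integers $x\in\{1,2,3,4\}$ and $k\ge 1$ with $2^k-x\ge 2^{k-1}$, we have $f_d(Q_{2^k-x})=2^k$.
   Context: $Q_n$ is the $n$-dimensional hypercube: vertices are binary strings of length $n$, adjacent iff they differ in exactly one position. The \emph{Explorer–Director game} on a finite connected graph $G$ with starting vertex $v$: a token starts on $v$; in each round, with the token on $u$, the Explorer names a distance $d$ such that some vertex is at distance $d$ from $u$, and the Director moves the token to any vertex at distance exactly $d$ from $u$. Visited vertices are those the token has ever occupied (including $v$). The Explorer maximizes and the Director minimizes the number of visited vertices; the game ends when the Director can keep the token on visited vertices indefinitely; $f_d(G,v)$ is the final number of visited vertices under optimal play. Since $Q_n$ is vertex-transitive, $f_d(Q_n,v)$ does not depend on $v$ and is written $f_d(Q_n)$. -}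

module Defs where

open import Data.Bool using (Bool; true; false; _xor_)
open import Data.Nat using (ℕ; zero; suc; _+_; _≤_)
open import Data.Vec using (Vec; []; _∷_)
open import Data.Vec.Properties using (≡-dec)
open import Data.Bool.Properties using () renaming (_≟_ to _≟B_)
open import Data.List using (List; []; _∷_; length)
open import Data.Product using (Σ; ∃; _×_; _,_)
open import Relation.Nullary using (¬_; yes; no)
open import Relation.Binary.PropositionalEquality using (_≡_)
import Data.List.Membership.DecPropositional as DecMem

Vertex : ℕ → Set
Vertex n = Vec Bool n

_≟V_ : ∀ {n} (u w : Vertex n) → Relation.Nullary.Dec (u ≡ w)
_≟V_ = ≡-dec _≟B_

-- Graph distance in Q_n = number of positions where the strings differ.
dist : ∀ {n} → Vertex n → Vertex n → ℕ
dist [] [] = 0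
dist (a ∷ u) (b ∷ w) with a ≟B b
... | yes _ = dist u w
... | no  _ = suc (dist u w)

insertV : ∀ {n} → Vertex n → List (Vertex n) → List (Vertex n)
insertV {n} w S with DecMem._∈?_ (_≟V_ {n}) w S
... | yes _ = S
... | no  _ = w ∷ S

-- ExplorerForces n m u S : in the Explorer–Director game on Q_n, with the
-- token on u and visited set S, the Explorer has a strategy guaranteeing
-- that at least m vertices get visited (in finitely many rounds, inductively).
data ExplorerForces (n m : ℕ) : Vertex n → List (Vertex n) → Set where
  reached : ∀ {u S} → m ≤ length S → ExplorerForces n m u S
  round   : ∀ {u S} (d : ℕ) →
            (∃ λ w → dist u w ≡ d) →
            (∀ w → dist u w ≡ d → ExplorerForces n m w (insertV w S)) →
            ExplorerForces n m u S

-- f_d(Q_n, v) = m : Explorer can force m visited vertices, but not m + 1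
-- (i.e. the Director can keep the number of visited vertices ≤ m forever).
FdIs : (n : ℕ) → Vertex n → ℕ → Set
FdIs n v m = ExplorerForces n m v (v ∷ []) × ¬ ExplorerForces n (suc m) v (v ∷ [])

-- A set R of vertices of Q_n is closed if from each of its vertices every distance 0, …, n is
-- realised inside R. The Director can keep the token inside any closed set containing the start;
-- conversely, while the visited set contains no nonempty closed set, some visited vertex misses a
-- distance within the part of the visited set still in play, and the Explorer uses it to force a
-- new vertex. So f_d(Q_n) is the least size of a closed set.
-- Upper bound: for 2^(k-1) ≤ n < 2^k, split Q_n = Q_L × Q_(2^(k-1) - 1) with 1 ≤ L ≤ 2^(k-1); an
-- antipodal pair of Q_L times a closed set of size 2^(k-1) of the second factor is closed, of size 2^k.
-- Lower bound: a closed set has a point at each distance from any of its points (≥ n + 1 points),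
-- is closed under antipodes (even size for n ≥ 1), and for even n so is each of its two parity
-- classes; counting points at even and odd distances then gives ≥ n + x points when n = 2^k - x.

module Submission where

open import Defs
open import Data.Bool using (true; false; not)
open import Data.Empty using (⊥-elim)
open import Data.Fin using (Fin; toℕ)
import Data.Fin.Properties as Fin
open import Data.List using (List; []; _∷_; length; filter; lookup; cartesianProductWith)
import Data.List as List
open import Data.List.Properties
  using (length-++; length-map; filter-accept; filter-reject; filter-all; filter-notAll)
open import Data.List.Membership.Propositional using (_∈_; _∉_; find; lose)
open import Data.List.Membership.Propositional.Properties
  using (∈-filter⁺; ∈-filter⁻; ∈-lookup; ∈-cartesianProductWith⁺; ∈-cartesianProductWith⁻)
import Data.List.Membership.DecPropositional as DecMembership
import Data.List.Membership.Setoid.Properties as SetoidMembership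
open import Data.List.Relation.Binary.Subset.Propositional using (_⊆_)
open import Data.List.Relation.Unary.All as All using (all?; []; _∷_)
open import Data.List.Relation.Unary.All.Properties using (¬Any⇒All¬)
open import Data.List.Relation.Unary.Any as Any using (here; there; index; any?)
open import Data.List.Relation.Unary.Unique.Propositional using (Unique; []; _∷_)
open import Data.List.Relation.Unary.Unique.Propositional.Properties
  using (cartesianProductWith⁺) renaming (filter⁺ to unique-filter⁺)
open import Data.Nat using (ℕ; zero; suc; _+_; _*_; _∸_; _^_; _≤_; _<_; _≥_; z≤n; s≤s; s≤s⁻¹)
open import Data.Nat.Base using (parity)
open import Data.Nat.Induction using (<-wellFounded)
open import Data.Nat.Properties
open import Data.Parity using (Parity; 0ℙ; 1ℙ; _⁻¹) renaming (_+_ to _⊕_)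
open import Data.Parity.Properties using (⁻¹-involutive; +-homo-+; *-homo-*; p≢p⁻¹) renaming (_≟_ to _≟ₚ_)
open import Data.Product using (∃; _×_; _,_; proj₁; proj₂)
open import Data.Sum using (_⊎_; inj₁; inj₂)
open import Data.Vec using ([]; _∷_; _++_; map; splitAt)
open import Data.Vec.Properties using (++-injective)
open import Function using (_∘_; id; case_of_)
open import Induction.WellFounded using (Acc; acc)
open import Relation.Binary.Definitions using (DecidableEquality)
open import Relation.Binary.PropositionalEquality
open import Relation.Nullary using (¬_; Dec; yes; no; ¬?; contradiction)

module _ {a} {A : Set a} where

  unique-∷ : ∀ {x} {xs : List A} → x ∉ xs → Unique xs → Unique (x ∷ xs)
  unique-∷ {x} {xs} x∉ u = ¬Any⇒All¬ {P = x ≡_} xs x∉ ∷ u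

  injection⇒≤length : ∀ {m} {xs : List A} (f : Fin m → A) → (∀ {i j} → f i ≡ f j → i ≡ j) →
                      (∀ i → f i ∈ xs) → m ≤ length xs
  injection⇒≤length {m} {xs} f f-injective f∈ with m ≤? length xs
  ... | yes m≤ = m≤
  ... | no m≰ with Fin.pigeonhole (≰⇒> m≰) (index ∘ f∈)
  ... | i , j , i<j , same-index = contradiction
          (f-injective (SetoidMembership.index-injective (setoid A) (f∈ i) (f∈ j) same-index))
          (Fin.<⇒≢ i<j)

  lookup-injective : ∀ {xs : List A} → Unique xs → ∀ {i j} → lookup xs i ≡ lookup xs j → i ≡ j
  lookup-injective (_ ∷ _) {Fin.zero} {Fin.zero} _ = refl
  lookup-injective (x≢ ∷ _) {Fin.zero} {Fin.suc j} e = contradiction e (All.lookup x≢ (∈-lookup j))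
  lookup-injective (x≢ ∷ _) {Fin.suc i} {Fin.zero} e = contradiction (sym e) (All.lookup x≢ (∈-lookup i))
  lookup-injective (_ ∷ u) {Fin.suc i} {Fin.suc j} e = cong Fin.suc (lookup-injective u e)

  unique-⊆⇒length≤ : ∀ {xs ys : List A} → Unique xs → xs ⊆ ys → length xs ≤ length ys
  unique-⊆⇒length≤ {xs} u xs⊆ys = injection⇒≤length (lookup xs) (lookup-injective u) (xs⊆ys ∘ ∈-lookup)

module Removal {a} {A : Set a} (_≟_ : DecidableEquality A) where

  open ≡-Reasoning

  infixl 5 _∖_
  _∖_ : List A → A → List A
  xs ∖ x = filter (λ y → ¬? (y ≟ x)) xs

  ∈-∖⁺ : ∀ {x y xs} → y ∈ xs → y ≢ x → y ∈ xs ∖ x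
  ∈-∖⁺ = ∈-filter⁺ (λ y → ¬? (y ≟ _))

  ∈-∖⁻ : ∀ {x y xs} → y ∈ xs ∖ x → y ∈ xs × y ≢ x
  ∈-∖⁻ = ∈-filter⁻ (λ y → ¬? (y ≟ _))

  unique-∖ : ∀ {x xs} → Unique xs → Unique (xs ∖ x)
  unique-∖ = unique-filter⁺ (λ y → ¬? (y ≟ _))

  length-∖< : ∀ {x xs} → x ∈ xs → length (xs ∖ x) < length xs
  length-∖< {xs = xs} x∈ = filter-notAll (λ y → ¬? (y ≟ _)) xs (Any.map (λ y≡x y≢x → y≢x (sym y≡x)) x∈)

  length-∖ : ∀ {x xs} → Unique xs → x ∈ xs → length xs ≡ suc (length (xs ∖ x))
  length-∖ {x} {_ ∷ xs} (x∉ ∷ _) (here refl) = cong (suc ∘ length) (sym (begin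
    (x ∷ xs) ∖ x  ≡⟨ filter-reject (λ y → ¬? (y ≟ x)) (λ x≢x → x≢x refl) ⟩
    xs ∖ x        ≡⟨ filter-all (λ y → ¬? (y ≟ x)) (All.map (λ x≢y y≡x → x≢y (sym y≡x)) x∉) ⟩
    xs            ∎))
  length-∖ {x} {y ∷ ys} (y∉ ∷ u) (there x∈) = begin
    suc (length ys)              ≡⟨ cong suc (length-∖ u x∈) ⟩
    suc (suc (length (ys ∖ x)))
      ≡⟨ cong (suc ∘ length) (filter-accept (λ z → ¬? (z ≟ x)) (All.lookup y∉ x∈)) ⟨
    suc (length ((y ∷ ys) ∖ x))  ∎

  involution⇒even-length : ∀ {xs} (σ : A → A) → Unique xs → (∀ {x} → x ∈ xs → σ x ∈ xs) →
                           (∀ {x} → x ∈ xs → σ (σ x) ≡ x) → (∀ {x} → x ∈ xs → σ x ≢ x) →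
                           parity (length xs) ≡ 0ℙ
  involution⇒even-length {xs} σ u closed involutive fixed-point-free =
    go xs u closed involutive fixed-point-free (<-wellFounded (length xs))
    where
    go : ∀ xs → Unique xs → (∀ {x} → x ∈ xs → σ x ∈ xs) → (∀ {x} → x ∈ xs → σ (σ x) ≡ x) →
         (∀ {x} → x ∈ xs → σ x ≢ x) → Acc _<_ (length xs) → parity (length xs) ≡ 0ℙ
    go [] _ _ _ _ _ = refl
    go (x ∷ ys) (x∉ys ∷ u) closed involutive fpf (acc rec) = begin
      parity (suc (length ys))             ≡⟨ cong (parity ∘ suc) (length-∖ u σx∈ys) ⟩
      parity (length zs)                   ≡⟨ go zs (unique-∖ u) zs-closed (involutive ∘ there ∘ in-ys)
                                                 (fpf ∘ there ∘ in-ys) (rec zs-shorter) ⟩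
      0ℙ                                   ∎
      where
      σx∈ys : σ x ∈ ys
      σx∈ys with closed (here refl)
      ... | here σx≡x = contradiction σx≡x (fpf (here refl))
      ... | there σx∈ = σx∈
      zs : List A
      zs = ys ∖ σ x
      in-ys : ∀ {z} → z ∈ zs → z ∈ ys
      in-ys = proj₁ ∘ ∈-∖⁻
      zs-shorter : length zs < suc (length ys)
      zs-shorter = m<n⇒m<1+n (length-∖< σx∈ys)
      zs-closed : ∀ {z} → z ∈ zs → σ z ∈ zs
      zs-closed {z} z∈ with ∈-∖⁻ z∈ | closed (there (in-ys z∈))
      ... | z∈ys , z≢σx | here σz≡x =
            contradiction (trans (sym (involutive (there z∈ys))) (cong σ σz≡x)) z≢σx
      ... | z∈ys , _ | there σz∈ys = ∈-∖⁺ σz∈ys λ σz≡σx →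
            All.lookup x∉ys z∈ys (sym (begin
              z        ≡⟨ involutive (there z∈ys) ⟨
              σ (σ z)  ≡⟨ cong σ σz≡σx ⟩
              σ (σ x)  ≡⟨ involutive (here refl) ⟩
              x        ∎))

length-cartesianProductWith : ∀ {a b c} {A : Set a} {B : Set b} {C : Set c} (f : A → B → C) xs ys →
                              length (cartesianProductWith f xs ys) ≡ length xs * length ys
length-cartesianProductWith f [] ys = refl
length-cartesianProductWith f (x ∷ xs) ys = begin
  length (List.map (f x) ys List.++ cartesianProductWith f xs ys)  ≡⟨ length-++ (List.map (f x) ys) ⟩
  length (List.map (f x) ys) + length (cartesianProductWith f xs ys)
    ≡⟨ cong₂ _+_ (length-map (f x) ys) (length-cartesianProductWith f xs ys) ⟩
  length ys + length xs * length ys  ∎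
  where open ≡-Reasoning

dist-refl : ∀ {n} (u : Vertex n) → dist u u ≡ 0
dist-refl [] = refl
dist-refl (true ∷ u) = dist-refl u
dist-refl (false ∷ u) = dist-refl u

dist-sym : ∀ {n} (u w : Vertex n) → dist u w ≡ dist w u
dist-sym [] [] = refl
dist-sym (true ∷ u) (true ∷ w) = dist-sym u w
dist-sym (true ∷ u) (false ∷ w) = cong suc (dist-sym u w)
dist-sym (false ∷ u) (true ∷ w) = cong suc (dist-sym u w)
dist-sym (false ∷ u) (false ∷ w) = dist-sym u w

dist≤ : ∀ {n} (u w : Vertex n) → dist u w ≤ n
dist≤ [] [] = z≤n
dist≤ (true ∷ u) (true ∷ w) = m≤n⇒m≤1+n (dist≤ u w)
dist≤ (true ∷ u) (false ∷ w) = s≤s (dist≤ u w)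
dist≤ (false ∷ u) (true ∷ w) = s≤s (dist≤ u w)
dist≤ (false ∷ u) (false ∷ w) = m≤n⇒m≤1+n (dist≤ u w)

point-at-distance : ∀ {n} (u : Vertex n) {d} → d ≤ n → ∃ λ w → dist u w ≡ d
point-at-distance u {zero} _ = u , dist-refl u
point-at-distance (true ∷ u) {suc d} (s≤s d≤n) =
  let w , w-at-d = point-at-distance u d≤n in false ∷ w , cong suc w-at-d
point-at-distance (false ∷ u) {suc d} (s≤s d≤n) =
  let w , w-at-d = point-at-distance u d≤n in true ∷ w , cong suc w-at-d

complement : ∀ {n} → Vertex n → Vertex n
complement = map not

complement-involutive : ∀ {n} (u : Vertex n) → complement (complement u) ≡ u
complement-involutive [] = refl
complement-involutive (true ∷ u) = cong (true ∷_) (complement-involutive u)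
complement-involutive (false ∷ u) = cong (false ∷_) (complement-involutive u)

dist-complement : ∀ {n} (u : Vertex n) → dist u (complement u) ≡ n
dist-complement [] = refl
dist-complement (true ∷ u) = cong suc (dist-complement u)
dist-complement (false ∷ u) = cong suc (dist-complement u)

dist≡n⇒complement : ∀ {n} (u w : Vertex n) → dist u w ≡ n → w ≡ complement u
dist≡n⇒complement [] [] _ = refl
dist≡n⇒complement (true ∷ u) (false ∷ w) e = cong (false ∷_) (dist≡n⇒complement u w (suc-injective e))
dist≡n⇒complement (false ∷ u) (true ∷ w) e = cong (true ∷_) (dist≡n⇒complement u w (suc-injective e))
dist≡n⇒complement {suc n} (true ∷ u) (true ∷ w) e = ⊥-elim (n≮n n (subst (_≤ n) e (dist≤ u w)))
dist≡n⇒complement {suc n} (false ∷ u) (false ∷ w) e = ⊥-elim (n≮n n (subst (_≤ n) e (dist≤ u w)))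

dist-++ : ∀ {l m} (a c : Vertex l) (b d : Vertex m) → dist (a ++ b) (c ++ d) ≡ dist a c + dist b d
dist-++ [] [] b d = refl
dist-++ (true ∷ a) (true ∷ c) b d = dist-++ a c b d
dist-++ (false ∷ a) (false ∷ c) b d = dist-++ a c b d
dist-++ (true ∷ a) (false ∷ c) b d = cong suc (dist-++ a c b d)
dist-++ (false ∷ a) (true ∷ c) b d = cong suc (dist-++ a c b d)

parity-2* : ∀ q → parity (2 * q) ≡ 0ℙ
parity-2* = *-homo-* 2

parity-suc : ∀ k → parity (suc k) ≡ parity k ⁻¹
parity-suc = +-homo-+ 1

odd≤even⇒< : ∀ {m k} → m ≤ k → parity m ≡ 1ℙ → parity k ≡ 0ℙ → m < k
odd≤even⇒< m≤k m-odd k-even =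
  ≤∧≢⇒< m≤k λ m≡k → case trans (sym m-odd) (trans (cong parity m≡k) k-even) of λ ()

⊕-⁻¹ : ∀ p q → (p ⊕ q) ⁻¹ ≡ p ⊕ q ⁻¹
⊕-⁻¹ 0ℙ q = refl
⊕-⁻¹ 1ℙ q = refl

parity-suc-⊕ : ∀ d q → parity (suc d) ⊕ q ≡ parity d ⊕ q ⁻¹
parity-suc-⊕ zero q = refl
parity-suc-⊕ (suc zero) q = sym (⁻¹-involutive q)
parity-suc-⊕ (suc (suc d)) q = parity-suc-⊕ d q

vparity : ∀ {n} → Vertex n → Parity
vparity [] = 0ℙ
vparity (false ∷ u) = vparity u
vparity (true ∷ u) = vparity u ⁻¹

parity-dist : ∀ {n} (u w : Vertex n) → vparity w ≡ parity (dist u w) ⊕ vparity u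
parity-dist [] [] = refl
parity-dist (false ∷ u) (false ∷ w) = parity-dist u w
parity-dist (true ∷ u) (true ∷ w) =
  trans (cong _⁻¹ (parity-dist u w)) (⊕-⁻¹ (parity (dist u w)) (vparity u))
parity-dist (false ∷ u) (true ∷ w) =
  trans (cong _⁻¹ (parity-dist u w))
        (trans (⊕-⁻¹ (parity (dist u w)) (vparity u)) (sym (parity-suc-⊕ (dist u w) (vparity u))))
parity-dist (true ∷ u) (false ∷ w) =
  trans (parity-dist u w)
        (trans (cong (parity (dist u w) ⊕_) (sym (⁻¹-involutive (vparity u))))
               (sym (parity-suc-⊕ (dist u w) (vparity u ⁻¹))))

complement-≢ : ∀ {n} → 1 ≤ n → (u : Vertex n) → u ≢ complement u
complement-≢ (s≤s z≤n) (true ∷ u) ()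
complement-≢ (s≤s z≤n) (false ∷ u) ()

vparity-complement : ∀ {n} (u : Vertex n) → vparity (complement u) ≡ parity n ⊕ vparity u
vparity-complement u =
  trans (parity-dist u (complement u)) (cong (λ d → parity d ⊕ vparity u) (dist-complement u))

Closed : ∀ {n} → List (Vertex n) → Set
Closed {n} R = ∀ {r} → r ∈ R → ∀ {d} → d ≤ n → ∃ λ w → w ∈ R × dist r w ≡ d

ClosedSetsAtLeast : ℕ → ℕ → Set
ClosedSetsAtLeast n m = ∀ {R : List (Vertex n)} {r} → Unique R → r ∈ R → Closed R → m ≤ length R

module _ {n : ℕ} where

  private
    V : Set
    V = Vertex n
    _∈?_ : (w : V) (S : List V) → Dec (w ∈ S)
    _∈?_ = DecMembership._∈?_ _≟V_
  open Removal (_≟V_ {n})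

  Gap : List V → Set
  Gap R = ∃ λ r → r ∈ R × ∃ λ d → d ≤ n × ∀ {w} → w ∈ R → dist r w ≢ d

  closed-or-gap : (R : List V) → Closed R ⊎ Gap R
  closed-or-gap R with any? (λ r → anyUpTo? (λ d → all? (λ w → ¬? (dist r w ≟ d)) R) (suc n)) R
  ... | yes gap = let r , r∈ , d , d<1+n , misses = find gap in
                  inj₂ (r , r∈ , d , s≤s⁻¹ d<1+n , All.lookup misses)
  ... | no no-gap = inj₁ λ {r} r∈ {d} d≤n → case any? (λ w → dist r w ≟ d) R of λ where
    (yes hit) → find hit
    (no miss) → contradiction (lose r∈ (d , s≤s d≤n , ¬Any⇒All¬ R miss)) no-gap

  insertV-elim : ∀ {w S} (P : List V → Set) → (w ∈ S → P S) → (w ∉ S → P (w ∷ S)) → P (insertV w S)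
  insertV-elim {w} {S} P old new with w ∈? S
  ... | yes w∈ = old w∈
  ... | no w∉ = new w∉

  insertV-unique : ∀ {w S} → Unique S → Unique (insertV w S)
  insertV-unique uS = insertV-elim Unique (λ _ → uS) (λ w∉ → unique-∷ w∉ uS)

  insertV-⊆ : ∀ {w S T} → S ⊆ T → w ∈ T → insertV w S ⊆ T
  insertV-⊆ {T = T} S⊆T w∈ =
    insertV-elim (_⊆ T) (λ _ → S⊆T) λ _ → λ { (here refl) → w∈ ; (there x∈) → S⊆T x∈ }

  director-confines : ∀ {T} → Closed T → ∀ {u S} → u ∈ T → Unique S → S ⊆ T →
                      ¬ ExplorerForces n (suc (length T)) u S
  director-confines closed u∈ uS S⊆T (reached T<S) = <⇒≱ T<S (unique-⊆⇒length≤ uS S⊆T)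
  director-confines closed {u} u∈ uS S⊆T (round d (w₀ , w₀-at-d) next) =
    let w , w∈ , w-at-d = closed u∈ (subst (_≤ n) w₀-at-d (dist≤ u w₀)) in
    director-confines closed w∈ (insertV-unique uS) (insertV-⊆ S⊆T w∈) (next w w-at-d)

  module _ {m} (large : ClosedSetsAtLeast n m) where

    -- R is the part of the visited set S still in play: from outside R the Explorer already wins.
    -- Were R closed, it would have at least m < |S| elements; so some r ∈ R misses a distance d
    -- inside R, and naming d from r either visits a new vertex or lands outside R.
    peel : ∀ {S} → ¬ m ≤ length S → (∀ {w} → w ∉ S → ExplorerForces n m w (w ∷ S)) →
           ∀ R → Acc _<_ (length R) → Unique R → R ⊆ S →
           (∀ {u} → u ∈ S → u ∉ R → ExplorerForces n m u S) →
           ∀ {u} → u ∈ S → ExplorerForces n m u S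
    peel small fresh [] _ _ _ outside u∈ = outside u∈ λ ()
    peel {S} small fresh R@(_ ∷ _) (acc rec) uR R⊆S outside u∈ with closed-or-gap R
    ... | inj₁ closed =
          contradiction (≤-trans (large uR (here refl) closed) (unique-⊆⇒length≤ uR R⊆S)) small
    ... | inj₂ (r , r∈ , d , d≤n , misses) =
          peel small fresh (R ∖ r) (rec (length-∖< r∈)) (unique-∖ uR) (R⊆S ∘ proj₁ ∘ ∈-∖⁻) outside′ u∈
      where
      from-r : ExplorerForces n m r S
      from-r = round d (point-at-distance r d≤n) λ w w-at-d →
        insertV-elim (ExplorerForces n m w) (λ w∈S → outside w∈S λ w∈R → misses w∈R w-at-d) fresh
      outside′ : ∀ {u} → u ∈ S → u ∉ R ∖ r → ExplorerForces n m u S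
      outside′ {u} u∈ u∉ with u ≟V r
      ... | yes refl = from-r
      ... | no u≢r = outside u∈ λ u∈R → u∉ (∈-∖⁺ u∈R u≢r)

    explorer-forces : ∀ f {S} → Unique S → m ≤ f + length S → ∀ {u} → u ∈ S → ExplorerForces n m u S
    explorer-forces zero uS m≤ _ = reached m≤
    explorer-forces (suc f) {S} uS m≤ u∈ with m ≤? length S
    ... | yes m≤S = reached m≤S
    ... | no m≰S = peel m≰S fresh S (<-wellFounded _) uS id (λ u∈ u∉ → contradiction u∈ u∉) u∈
      where
      fresh : ∀ {w} → w ∉ S → ExplorerForces n m w (w ∷ S)
      fresh w∉ =
        explorer-forces f (unique-∷ w∉ uS) (subst (m ≤_) (sym (+-suc f (length S))) m≤) (here refl)

  record ClosedSetAround (v : V) (s : ℕ) : Set where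
    field
      members  : List V
      unique   : Unique members
      contains : v ∈ members
      closed   : Closed members
      size     : length members ≡ s

  fd-of-closed-set : ∀ {v s} → ClosedSetAround v s → ClosedSetsAtLeast n s → FdIs n v s
  fd-of-closed-set {v} {s} T large =
    explorer-forces large s single (m≤m+n s 1) (here refl) ,
    subst (λ k → ¬ ExplorerForces n (suc k) v (v ∷ [])) size
          (director-confines closed contains single λ { (here refl) → contains })
    where
    open ClosedSetAround T
    single : Unique (v ∷ [])
    single = All.[] ∷ []

-- The product of the antipodal pair {a, ā} of Q_L with a closed set of Q_m: distances up to m are
-- realised in the a-layer, larger ones (at least L, as L ≤ m + 1) in the ā-layer.
closed-set-double : ∀ {L m n s} → n ≡ L + m → 1 ≤ L → L ≤ suc m →
                    (∀ (v : Vertex m) → ClosedSetAround v s) → (v : Vertex n) → ClosedSetAround v (2 * s)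
closed-set-double {L} {m} refl 1≤L L≤1+m around v with splitAt L v
... | a , b , refl = record
  { members  = T
  ; unique   = cartesianProductWith⁺ {xs = ends} _++_ (λ e → ++-injective _ _ e) unique-ends unique
  ; contains = ∈-cartesianProductWith⁺ _++_ {xs = ends} (here refl) contains
  ; closed   = T-closed
  ; size     = trans (length-cartesianProductWith _++_ ends members) (cong (2 *_) size)
  }
  where
  open ClosedSetAround (around b)
  ends : List (Vertex L)
  ends = a ∷ complement a ∷ []
  T : List (Vertex (L + m))
  T = cartesianProductWith _++_ ends members
  unique-ends : Unique ends
  unique-ends = (complement-≢ 1≤L a ∷ []) ∷ [] ∷ []
  opposite-end : ∀ {x} → x ∈ ends → complement x ∈ ends
  opposite-end (here refl) = there (here refl)
  opposite-end (there (here refl)) = here (complement-involutive a)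
  T-closed : Closed T
  T-closed t∈ {d} d≤ with ∈-cartesianProductWith⁻ _++_ ends members t∈
  ... | x , y , x∈ , y∈ , refl with d ≤? m
  ...   | yes d≤m = let y′ , y′∈ , y′-at-d = closed y∈ d≤m in
          x ++ y′ , ∈-cartesianProductWith⁺ _++_ x∈ y′∈ ,
          trans (dist-++ x x y y′) (cong₂ _+_ (dist-refl x) y′-at-d)
  ...   | no d≰m = let y′ , y′∈ , y′-at-d = closed y∈ {d ∸ L} (m≤n+o⇒m∸n≤o d L d≤) in
          complement x ++ y′ , ∈-cartesianProductWith⁺ _++_ (opposite-end x∈) y′∈ ,
          trans (dist-++ x (complement x) y y′)
                (trans (cong₂ _+_ (dist-complement x) y′-at-d) (m+[n∸m]≡n (≤-trans L≤1+m (≰⇒> d≰m))))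

closed-point : ClosedSetAround [] 1
closed-point = record
  { members  = [] ∷ []
  ; unique   = [] ∷ []
  ; contains = here refl
  ; closed   = λ { (here refl) z≤n → [] , here refl , refl }
  ; size     = refl
  }

mutual

  closed-set-between : ∀ j {n} → 2 ^ j ≤ n → n < 2 ^ suc j →
                       (v : Vertex n) → ClosedSetAround v (2 ^ suc j)
  closed-set-between j {n} 2^j≤n n<2^[1+j] =
    closed-set-double (sym (m∸n+n≡m (<⇒≤ m<n))) (m<n⇒0<n∸m m<n) (m≤n+o⇒m∸n≤o n m n≤m+1+m)
                      (closed-set-full j 1+m≡2^j)
    where
    P : ℕ
    P = 2 ^ j
    m : ℕ
    m = proj₁ (m≤n⇒∃[o]m+o≡n (m^n>0 2 j))
    1+m≡2^j : suc m ≡ P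
    1+m≡2^j = proj₂ (m≤n⇒∃[o]m+o≡n (m^n>0 2 j))
    m<n : m < n
    m<n = ≤-trans (≤-reflexive 1+m≡2^j) 2^j≤n
    n≤m+1+m : n ≤ m + suc m
    n≤m+1+m =
      s≤s⁻¹ (subst (n <_) (cong₂ _+_ (sym 1+m≡2^j) (trans (+-identityʳ P) (sym 1+m≡2^j))) n<2^[1+j])

  closed-set-full : ∀ j {m} → suc m ≡ 2 ^ j → (v : Vertex m) → ClosedSetAround v (2 ^ j)
  closed-set-full zero {zero} refl [] = closed-point
  closed-set-full (suc j) {m} 1+m≡2^[1+j] = closed-set-between j 2^j≤m (≤-reflexive 1+m≡2^[1+j])
    where
    P : ℕ
    P = 2 ^ j
    2^j≤m : P ≤ m
    2^j≤m = s≤s⁻¹ (begin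
      suc P       ≡⟨ +-comm 1 P ⟩
      P + 1       ≤⟨ +-monoʳ-≤ P (≤-trans (m^n>0 2 j) (m≤m+n P 0)) ⟩
      P + (P + 0) ≡⟨ 1+m≡2^[1+j] ⟨
      suc m       ∎)
      where open ≤-Reasoning

distinct-distances⇒≤length : ∀ {n m} {xs : List (Vertex n)} (u : Vertex n) (h : Fin m → ℕ) →
                             (∀ {i j} → h i ≡ h j → i ≡ j) → (∀ i → ∃ λ w → w ∈ xs × dist u w ≡ h i) →
                             m ≤ length xs
distinct-distances⇒≤length u h h-injective cover =
  injection⇒≤length (proj₁ ∘ cover)
    (λ {i} {j} same → h-injective (trans (sym (proj₂ (proj₂ (cover i))))
                                         (trans (cong (dist u) same) (proj₂ (proj₂ (cover j))))))
    (proj₁ ∘ proj₂ ∘ cover)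

module _ {n : ℕ} where

  class : Parity → List (Vertex n) → List (Vertex n)
  class p = filter (λ w → vparity w ≟ₚ p)

  length-classes : ∀ p xs → length (class p xs) + length (class (p ⁻¹) xs) ≡ length xs
  length-classes p [] = refl
  length-classes p (w ∷ xs) with vparity w ≟ₚ p | vparity w ≟ₚ p ⁻¹
  ... | yes refl | yes w≡w⁻¹ = contradiction w≡w⁻¹ (p≢p⁻¹ p)
  ... | yes _ | no _ = cong suc (length-classes p xs)
  ... | no _ | yes _ = trans (+-suc _ _) (cong suc (length-classes p xs))
  ... | no w∉p | no w∉p⁻¹ = contradiction (≢⇒≡⁻¹ (vparity w) p w∉p) w∉p⁻¹
    where
    ≢⇒≡⁻¹ : ∀ q p → q ≢ p → q ≡ p ⁻¹
    ≢⇒≡⁻¹ 0ℙ 0ℙ q≢p = contradiction refl q≢p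
    ≢⇒≡⁻¹ 0ℙ 1ℙ _ = refl
    ≢⇒≡⁻¹ 1ℙ 0ℙ _ = refl
    ≢⇒≡⁻¹ 1ℙ 1ℙ q≢p = contradiction refl q≢p

module ClosedSet {n : ℕ} {R : List (Vertex n)} (uR : Unique R) (R-closed : Closed R) where

  open Removal (_≟V_ {n})

  complement-∈ : ∀ {u} → u ∈ R → complement u ∈ R
  complement-∈ {u} u∈ = let w , w∈ , w-at-n = R-closed u∈ ≤-refl in
    subst (_∈ R) (dist≡n⇒complement u w w-at-n) w∈

  even-length : 1 ≤ n → parity (length R) ≡ 0ℙ
  even-length 1≤n = involution⇒even-length complement uR complement-∈
    (λ {u} _ → complement-involutive u) (λ {u} _ → ≢-sym (complement-≢ 1≤n u))

  class-even-length : parity n ≡ 0ℙ → 1 ≤ n → ∀ p → parity (length (class p R)) ≡ 0ℙ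
  class-even-length n-even 1≤n p = involution⇒even-length complement (unique-filter⁺ _ uR) closure
    (λ {u} _ → complement-involutive u) (λ {u} _ → ≢-sym (complement-≢ 1≤n u))
    where
    closure : ∀ {u} → u ∈ class p R → complement u ∈ class p R
    closure {u} u∈ = let u∈R , u-in-p = ∈-filter⁻ _ u∈ in
      ∈-filter⁺ _ (complement-∈ u∈R)
        (trans (vparity-complement u) (trans (cong (_⊕ vparity u) n-even) u-in-p))

  class-count : ∀ {u m} → u ∈ R → (h : Fin m → ℕ) → (∀ {i j} → h i ≡ h j → i ≡ j) → (∀ i → h i ≤ n) →
                ∀ p → (∀ i → parity (h i) ≡ p) → m ≤ length (class (p ⊕ vparity u) R)
  class-count {u} u∈ h h-injective h≤n p parity-h = distinct-distances⇒≤length u h h-injective λ i →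
    let w , w∈ , w-at-h = R-closed u∈ (h≤n i) in
    w , ∈-filter⁺ _ w∈ (trans (parity-dist u w)
                              (cong (_⊕ vparity u) (trans (cong parity w-at-h) (parity-h i)))) ,
    w-at-h

  class-evens : ∀ {u q} → u ∈ R → 2 * q ≤ n → suc q ≤ length (class (vparity u) R)
  class-evens u∈ 2q≤n = class-count u∈ (λ i → 2 * toℕ i) (Fin.toℕ-injective ∘ *-cancelˡ-≡ _ _ 2)
    (λ i → ≤-trans (*-monoʳ-≤ 2 (Fin.toℕ≤pred[n] i)) 2q≤n) 0ℙ (parity-2* ∘ toℕ)

  class-odds : ∀ {u q} → u ∈ R → suc (2 * q) ≤ n → suc q ≤ length (class (vparity u ⁻¹) R)
  class-odds u∈ 1+2q≤n = class-count u∈ (λ i → suc (2 * toℕ i))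
    (Fin.toℕ-injective ∘ *-cancelˡ-≡ _ _ 2 ∘ suc-injective)
    (λ i → ≤-trans (s≤s (*-monoʳ-≤ 2 (Fin.toℕ≤pred[n] i))) 1+2q≤n)
    1ℙ (λ i → trans (parity-suc (2 * toℕ i)) (cong _⁻¹ (parity-2* (toℕ i))))

  opposite-class-member : 1 ≤ n → ∀ {u} → u ∈ R → ∃ λ w → w ∈ R × vparity w ≡ vparity u ⁻¹
  opposite-class-member 1≤n {u} u∈ = let w , w∈ , w-at-1 = R-closed u∈ 1≤n in
    w , w∈ , trans (parity-dist u w) (cong (λ d → parity d ⊕ vparity u) w-at-1)

  tight⇒unique-at-distance : length R ≡ suc n → ∀ {u w w′} → u ∈ R → w ∈ R → w′ ∈ R →
                             dist u w ≡ dist u w′ → w ≡ w′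
  tight⇒unique-at-distance tight {u} {w} {w′} u∈ w∈ w′∈ same with w ≟V w′
  ... | yes w≡w′ = w≡w′
  ... | no w≢w′ =
    ⊥-elim (n≮n n (subst (suc n ≤_) (suc-injective (trans (sym (length-∖ uR w∈)) tight)) covered))
    where
    covered : suc n ≤ length (R ∖ w)
    covered = distinct-distances⇒≤length u toℕ Fin.toℕ-injective λ i →
      let c , c∈ , c-at-i = R-closed u∈ (Fin.toℕ≤pred[n] i) in
      case c ≟V w of λ where
        (yes refl) → w′ , ∈-∖⁺ w′∈ (≢-sym w≢w′) , trans (sym same) c-at-i
        (no c≢w) → c , ∈-∖⁺ c∈ c≢w , c-at-i

  pointAt : ℕ → Vertex n → Vertex n
  pointAt d u with any? (λ w → dist u w ≟ d) R
  ... | yes hit = proj₁ (find hit)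
  ... | no _ = u

  pointAt-spec : ∀ {u d} → u ∈ R → d ≤ n → pointAt d u ∈ R × dist u (pointAt d u) ≡ d
  pointAt-spec {u} {d} u∈ d≤n with any? (λ w → dist u w ≟ d) R
  ... | yes hit = proj₂ (find hit)
  ... | no miss = let _ , w∈ , w-at-d = R-closed u∈ d≤n in contradiction (lose w∈ w-at-d) miss

  module _ {q} (n≡1+2q : n ≡ suc (2 * q)) (tight : length R ≡ suc n) where

    tight-class-size : ∀ {u} → u ∈ R → length (class (vparity u) R) ≡ suc q
    tight-class-size {u} u∈ = ≤-antisym (+-cancelʳ-≤ (suc q) _ _ (begin
      length (class p R) + suc q                     ≤⟨ +-monoʳ-≤ _ (class-odds u∈ (≤-reflexive (sym n≡1+2q))) ⟩
      length (class p R) + length (class (p ⁻¹) R)   ≡⟨ length-classes p R ⟩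
      length R                                       ≡⟨ trans tight (cong suc n≡1+2q) ⟩
      2 + 2 * q                                      ≡⟨ *-suc 2 q ⟨
      suc q + (suc q + 0)                            ≡⟨ cong (suc q +_) (+-identityʳ (suc q)) ⟩
      suc q + suc q                                  ∎))
      (class-evens u∈ (≤-trans (n≤1+n _) (≤-reflexive (sym n≡1+2q))))
      where
      p = vparity u
      open ≤-Reasoning

    tight-class-even : 1 ≤ q → ∀ {u} → u ∈ R → parity (length (class (vparity u) R)) ≡ 0ℙ
    tight-class-even 1≤q {u} u∈ =
      involution⇒even-length τ (unique-filter⁺ _ uR) τ-closed τ-involutive τ-fixed-point-free
      where
      A : List (Vertex n)
      A = class (vparity u) R
      τ : Vertex n → Vertex n
      τ = pointAt (2 * q)
      τ-spec : ∀ {x} → x ∈ R → τ x ∈ R × dist x (τ x) ≡ 2 * q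
      τ-spec x∈ = pointAt-spec x∈ (≤-trans (n≤1+n _) (≤-reflexive (sym n≡1+2q)))
      in-R : ∀ {x} → x ∈ A → x ∈ R
      in-R = proj₁ ∘ ∈-filter⁻ _
      τ-closed : ∀ {x} → x ∈ A → τ x ∈ A
      τ-closed {x} x∈ = let x∈R , x-in-A = ∈-filter⁻ _ x∈ ; τx∈R , τx-at-2q = τ-spec x∈R in
        ∈-filter⁺ _ τx∈R (trans (parity-dist x (τ x))
                                (trans (cong (λ d → parity d ⊕ vparity x) τx-at-2q)
                                       (trans (cong (_⊕ vparity x) (parity-2* q)) x-in-A)))
      τ-involutive : ∀ {x} → x ∈ A → τ (τ x) ≡ x
      τ-involutive {x} x∈ =
        let x∈R = in-R x∈ ; τx∈R , τx-at-2q = τ-spec x∈R ; ττx∈R , ττx-at-2q = τ-spec τx∈R in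
        tight⇒unique-at-distance tight τx∈R ττx∈R x∈R
          (trans ττx-at-2q (sym (trans (dist-sym (τ x) x) τx-at-2q)))
      τ-fixed-point-free : ∀ {x} → x ∈ A → τ x ≢ x
      τ-fixed-point-free {x} x∈ τx≡x = <⇒≢ (≤-trans 1≤q (m≤n*m q 2))
        (trans (sym (dist-refl x)) (trans (cong (dist x) (sym τx≡x)) (proj₂ (τ-spec (in-R x∈)))))

closed⇒1+n≤length : ∀ {n} → ClosedSetsAtLeast n (suc n)
closed⇒1+n≤length {r = r} uR r∈ R-closed =
  distinct-distances⇒≤length r toℕ Fin.toℕ-injective λ i → R-closed r∈ (Fin.toℕ≤pred[n] i)

closed⇒2+n≤length : ∀ {n} → parity n ≡ 0ℙ → 1 ≤ n → ClosedSetsAtLeast n (2 + n)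
closed⇒2+n≤length {n} n-even 1≤n uR r∈ R-closed =
  odd≤even⇒< (closed⇒1+n≤length uR r∈ R-closed) (trans (parity-suc n) (cong _⁻¹ n-even))
             (ClosedSet.even-length uR R-closed 1≤n)

closed⇒4+n≤length : ∀ {n q} → n ≡ 2 * q → 1 ≤ q → parity q ≡ 0ℙ → ClosedSetsAtLeast n (4 + n)
closed⇒4+n≤length {n} {q} n≡2q 1≤q q-even {R} {r} uR r∈ R-closed = begin
  4 + n                                                           ≡⟨ cong (4 +_) n≡2q ⟩
  2 * 2 + 2 * q                                                   ≡⟨ *-distribˡ-+ 2 2 q ⟨
  (2 + q) + ((2 + q) + 0)                                         ≡⟨ cong ((2 + q) +_) (+-identityʳ (2 + q)) ⟩
  (2 + q) + (2 + q)                                               ≤⟨ +-mono-≤ (class-size r∈) opposite-size ⟩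
  length (class (vparity r) R) + length (class (vparity r ⁻¹) R)  ≡⟨ length-classes (vparity r) R ⟩
  length R                                                        ∎
  where
  open ClosedSet uR R-closed
  open ≤-Reasoning
  n-even : parity n ≡ 0ℙ
  n-even = trans (cong parity n≡2q) (parity-2* q)
  1≤n : 1 ≤ n
  1≤n = ≤-trans 1≤q (subst (q ≤_) (sym n≡2q) (m≤n*m q 2))
  class-size : ∀ {u} → u ∈ R → 2 + q ≤ length (class (vparity u) R)
  class-size u∈ = odd≤even⇒< (class-evens u∈ (≤-reflexive (sym n≡2q)))
                             (trans (parity-suc q) (cong _⁻¹ q-even)) (class-even-length n-even 1≤n _)
  opposite-size : 2 + q ≤ length (class (vparity r ⁻¹) R)
  opposite-size = let w , w∈ , w-opposite = opposite-class-member 1≤n r∈ in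
    subst (λ p → 2 + q ≤ length (class p R)) w-opposite (class-size w∈)

-- Here n + 1 ≤ |R| and |R| is even, so it suffices to rule out |R| = n + 1. Then every distance
-- is realised exactly once from each point of R, each parity class has q + 1 points, and the
-- point at distance 2q pairs up a parity class, making q + 1 even.
closed⇒3+n≤length : ∀ {n q} → n ≡ suc (2 * q) → 1 ≤ q → parity q ≡ 0ℙ → ClosedSetsAtLeast n (3 + n)
closed⇒3+n≤length {n} {q} n≡1+2q 1≤q q-even {R} {r} uR r∈ R-closed =
  odd≤even⇒< (≤∧≢⇒< (closed⇒1+n≤length uR r∈ R-closed) (not-tight ∘ sym))
             (trans (cong parity n≡1+2q) (trans (parity-suc (2 * q)) (cong _⁻¹ (parity-2* q))))
             (even-length (subst (1 ≤_) (sym n≡1+2q) (s≤s z≤n)))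
  where
  open ClosedSet uR R-closed
  odd-half : parity (suc q) ≡ 1ℙ
  odd-half = trans (parity-suc q) (cong _⁻¹ q-even)
  not-tight : length R ≢ suc n
  not-tight tight = case trans (sym odd-half)
                              (trans (cong parity (sym (tight-class-size {q} n≡1+2q tight r∈)))
                                     (tight-class-even {q} n≡1+2q tight 1≤q r∈)) of λ ()

2^j∸2-even : ∀ j → 2 ≤ 2 ^ j → ∃ λ q → 2 + q ≡ 2 ^ j × parity q ≡ 0ℙ
2^j∸2-even zero (s≤s ())
2^j∸2-even (suc j) 2≤P =
  let q , 2+q≡P = m≤n⇒∃[o]m+o≡n 2≤P in q , 2+q≡P , trans (cong parity 2+q≡P) (parity-2* (2 ^ j))

2^[1+j]≡2q+4 : ∀ j {q} → 2 + q ≡ 2 ^ j → 2 ^ suc j ≡ 2 * q + 4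
2^[1+j]≡2q+4 j {q} 2+q≡P = begin
  2 * 2 ^ j        ≡⟨ cong (2 *_) 2+q≡P ⟨
  2 * (2 + q)      ≡⟨ *-distribˡ-+ 2 2 q ⟩
  4 + 2 * q        ≡⟨ +-comm 4 (2 * q) ⟩
  2 * q + 4        ∎
  where open ≡-Reasoning

closed-set-lower-bound : ∀ {n} j x → n + x ≡ 2 ^ suc j → 1 ≤ x → x ≤ 4 → x ≤ 2 ^ j →
                         ClosedSetsAtLeast n (2 ^ suc j)
closed-set-lower-bound {n} j 1 n+1≡2P _ _ _ =
  subst (ClosedSetsAtLeast n) (trans (+-comm 1 n) n+1≡2P) closed⇒1+n≤length
closed-set-lower-bound {n} j 2 n+2≡2P _ _ 2≤P =
  subst (ClosedSetsAtLeast n) 2+n≡2P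
        (closed⇒2+n≤length (trans (cong parity 2+n≡2P) (parity-2* (2 ^ j))) 1≤n)
  where
  2+n≡2P : 2 + n ≡ 2 ^ suc j
  2+n≡2P = trans (+-comm 2 n) n+2≡2P
  1≤n : 1 ≤ n
  1≤n = ≤-trans (n≤1+n 1) (s≤s⁻¹ (s≤s⁻¹ (subst (4 ≤_) (sym 2+n≡2P) (*-monoʳ-≤ 2 2≤P))))
closed-set-lower-bound {n} j 3 n+3≡2P _ _ 3≤P with 2^j∸2-even j (≤-trans (n≤1+n 2) 3≤P)
... | q , 2+q≡P , q-even =
  subst (ClosedSetsAtLeast n) (trans (+-comm 3 n) n+3≡2P) (closed⇒3+n≤length n≡1+2q 1≤q q-even)
  where
  n≡1+2q : n ≡ suc (2 * q)
  n≡1+2q = +-cancelʳ-≡ 3 n _ (trans n+3≡2P (trans (2^[1+j]≡2q+4 j 2+q≡P) (+-suc (2 * q) 3)))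
  1≤q : 1 ≤ q
  1≤q = s≤s⁻¹ (s≤s⁻¹ (subst (3 ≤_) (sym 2+q≡P) 3≤P))
closed-set-lower-bound {n} j 4 n+4≡2P _ _ 4≤P with 2^j∸2-even j (≤-trans (≤-trans (n≤1+n 2) (n≤1+n 3)) 4≤P)
... | q , 2+q≡P , q-even =
  subst (ClosedSetsAtLeast n) (trans (+-comm 4 n) n+4≡2P) (closed⇒4+n≤length n≡2q 1≤q q-even)
  where
  n≡2q : n ≡ 2 * q
  n≡2q = +-cancelʳ-≡ 4 n _ (trans n+4≡2P (2^[1+j]≡2q+4 j 2+q≡P))
  1≤q : 1 ≤ q
  1≤q = ≤-trans (n≤1+n 1) (s≤s⁻¹ (s≤s⁻¹ (subst (4 ≤_) (sym 2+q≡P) 4≤P)))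
closed-set-lower-bound j (suc (suc (suc (suc (suc _))))) _ _ (s≤s (s≤s (s≤s (s≤s ())))) _

theorem4p7 : (x k : ℕ) → 1 ≤ x → x ≤ 4 → 1 ≤ k → 2 ^ k ∸ x ≥ 2 ^ (k ∸ 1) →
             (v : Vertex (2 ^ k ∸ x)) → FdIs (2 ^ k ∸ x) v (2 ^ k)
theorem4p7 _ zero _ _ () _ _
theorem4p7 x (suc j) 1≤x x≤4 _ 2^j≤n v =
  fd-of-closed-set (closed-set-between j 2^j≤n n<2^[1+j] v)
                   (closed-set-lower-bound j x n+x≡2^[1+j] 1≤x x≤4 x≤2^j)
  where
  P : ℕ
  P = 2 ^ j
  x<2^[1+j] : x < 2 * P
  x<2^[1+j] = m∸n≢0⇒n<m λ n≡0 → n≮0 (≤-trans (m^n>0 2 j) (subst (P ≤_) n≡0 2^j≤n))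
  n+x≡2^[1+j] : 2 * P ∸ x + x ≡ 2 * P
  n+x≡2^[1+j] = m∸n+n≡m (<⇒≤ x<2^[1+j])
  n<2^[1+j] : 2 * P ∸ x < 2 * P
  n<2^[1+j] = ∸-monoʳ-< 1≤x (<⇒≤ x<2^[1+j])
  x≤2^j : x ≤ P
  x≤2^j = +-cancelˡ-≤ P x P
    (subst (P + x ≤_) (cong (P +_) (+-identityʳ P)) (m≤o∸n⇒m+n≤o P (<⇒≤ x<2^[1+j]) 2^j≤n))
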